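{- In the table with $4$ rows, for all $s\ge1$, $\mathcal{D}(s,1)=\mathcal{F}_{2s-1}$ and $\mathcal{D}(s,2)=\mathcal{F}_{2s}$. Consequently, for all $s,t\ge1$, \[\mathcal{D}(s,1)\,\mathcal{D}(s+t,2)-\mathcal{D}(s,2)\,\mathcal{D}(s+t,1)=\mathcal{D}(t,2).\]
   Context: For $m\ge1$, $s\ge1$, $1\le t\le m$, $\mathcal{D}(s,t)$ (in the table with $m$ rows; here $m=4$) is the number of sequences $(r_1,\dots,r_s)$ with $r_i\in\{1,\dots,m\}$, $|r_{i+1}-r_i|\le1$ and $r_s=t$, i.e. the number of lattice paths with steps $(1,0),(1,1),(1,-1)$ from any cell of the first column to the cell in column $s$, row $t$, staying inside the table. $\mathcal{F}_k$ is the Fibonacci sequence: $\mathcal{F}_0=0$, $\mathcal{F}_1=1$, $\mathcal{F}_k=\mathcal{F}_{k-1}+\mathcal{F}_{k-2}$. -}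

module Defs where

open import Data.Nat using (ℕ; zero; suc; _+_; _≤_; _∸_)
open import Data.Bool using (Bool; true; false; _∧_)
open import Data.List using (List; []; _∷_; map; concatMap; length; filter)
open import Data.Vec using (Vec; []; _∷_)
open import Data.Fin using (Fin; toℕ)
open import Data.List using (allFin)
open import Relation.Nullary.Decidable using (⌊_⌋)
open import Data.Nat using (_≤?_; _≟_)
open import Function using (_∘_)
import Relation.Unary as U
open import Relation.Nullary using (Dec; yes; no)

F : ℕ → ℕ
F zero = 0
F (suc zero) = 1
F (suc (suc k)) = F (suc k) + F k

-- Rows are 1..m; we represent row r by (suc (toℕ i)) for i : Fin m.
row : {m : ℕ} → Fin m → ℕ
row i = suc (toℕ i)

allSeqs : (m s : ℕ) → List (Vec (Fin m) s)
allSeqs m zero = [] ∷ []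
allSeqs m (suc s) = concatMap (λ r → map (r ∷_) (allSeqs m s)) (allFin m)

dist : ℕ → ℕ → ℕ
dist a b = (a ∸ b) + (b ∸ a)

adj? : ℕ → ℕ → Bool
adj? a b = ⌊ dist a b ≤? 1 ⌋

steps? : {m s : ℕ} → Vec (Fin m) s → Bool
steps? [] = true
steps? (x ∷ []) = true
steps? (x ∷ y ∷ v) = adj? (row x) (row y) ∧ steps? (y ∷ v)

lastIs? : {m s : ℕ} → ℕ → Vec (Fin m) s → Bool
lastIs? t [] = false
lastIs? t (x ∷ []) = ⌊ row x ≟ t ⌋
lastIs? t (x ∷ y ∷ v) = lastIs? t (y ∷ v)

valid? : {m s : ℕ} → ℕ → Vec (Fin m) s → Bool
valid? t v = steps? v ∧ lastIs? t v

countTrue : {A : Set} → (A → Bool) → List A → ℕ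
countTrue p [] = 0
countTrue p (x ∷ xs) with p x
... | true = suc (countTrue p xs)
... | false = countTrue p xs

-- D m s t : number of sequences (r_1,…,r_s), r_i ∈ {1,…,m},
-- |r_{i+1} - r_i| ≤ 1, r_s = t   (table with m rows)
D : (m s t : ℕ) → ℕ
D m s t = countTrue (valid? t) (allSeqs m s)

private
  open import Relation.Binary.PropositionalEquality using (_≡_; refl)
  c1 : D 4 3 1 ≡ F 5
  c1 = refl
  c2 : D 4 4 2 ≡ F 8
  c2 = refl

-- Splitting a path at its first step shows that the vector of path counts by starting row
-- evolves under the symmetric 4×4 adjacency matrix A of the rows.  By symmetry D(s+1, t)
-- is the t-th entry of Aˢ𝟙, and Aˢ𝟙 = (F₂ₛ₊₁, F₂ₛ₊₂, F₂ₛ₊₂, F₂ₛ₊₁) because A maps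
-- (x, y, y, x) to (x+y, x+2y, x+2y, x+y).  The determinant identity is then d'Ocagne's
-- identity F₂ₐ₊₁ F₂ₐ₊ₖ₊₃ − F₂ₐ₊₂ F₂ₐ₊ₖ₊₂ = Fₖ₊₁, proved two indices at a time.
module Submission where

open import Defs
open import Data.Nat using (ℕ; _+_; _*_; _≥_; _∸_)
open import Data.Integer using (ℤ; +_; _-_)
open import Data.Product using (_×_)
open import Relation.Binary.PropositionalEquality using (_≡_)

open import Data.Bool using (Bool; true; false; _∧_; if_then_else_)
open import Data.Bool.Properties using (∧-assoc)
open import Data.Fin using (Fin)
open import Data.Integer using (_⊖_)
open import Data.Integer.Properties using ([+m]-[+n]≡m⊖n; ⊖-≥)
open import Data.List using (List; []; _∷_; _++_; map; concatMap; allFin)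
open import Data.Nat.ListAction using (sum)
open import Data.List.Properties using (map-cong)
open import Data.Nat using (zero; suc)
import Data.Nat as ℕ
open import Data.Nat.Properties using (+-identityʳ; +-comm; +-suc; *-suc; m≤m+n; m+n∸m≡n)
open import Data.Nat.Tactic.RingSolver using (solve-∀)
open import Data.Product using (_,_)
open import Data.Vec using () renaming (_∷_ to _∷ᵥ_)
open import Function using (_∘_)
open import Relation.Binary.PropositionalEquality
  using (refl; sym; trans; cong; cong₂; subst; module ≡-Reasoning)

open ≡-Reasoning

countTrue-++ : {A : Set} (p : A → Bool) (xs ys : List A) →
  countTrue p (xs ++ ys) ≡ countTrue p xs + countTrue p ys
countTrue-++ p []       ys = refl
countTrue-++ p (x ∷ xs) ys with p x
... | true  = cong suc (countTrue-++ p xs ys)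
... | false = countTrue-++ p xs ys

countTrue-cong : {A : Set} {p q : A → Bool} → (∀ x → p x ≡ q x) → (xs : List A) →
  countTrue p xs ≡ countTrue q xs
countTrue-cong             p≗q []       = refl
countTrue-cong {p = p} {q} p≗q (x ∷ xs) with p x | q x | p≗q x
... | true  | .true  | refl = cong suc (countTrue-cong p≗q xs)
... | false | .false | refl = countTrue-cong p≗q xs

countTrue-const-false : {A : Set} (xs : List A) → countTrue (λ _ → false) xs ≡ 0
countTrue-const-false []       = refl
countTrue-const-false (x ∷ xs) = countTrue-const-false xs

countTrue-∧ˡ : {A : Set} (b : Bool) (p : A → Bool) (xs : List A) →
  countTrue (λ x → b ∧ p x) xs ≡ (if b then countTrue p xs else 0)
countTrue-∧ˡ true  p xs = refl
countTrue-∧ˡ false p xs = countTrue-const-false xs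

countTrue-map : {A B : Set} (p : B → Bool) (f : A → B) (xs : List A) →
  countTrue p (map f xs) ≡ countTrue (p ∘ f) xs
countTrue-map p f []       = refl
countTrue-map p f (x ∷ xs) with p (f x)
... | true  = cong suc (countTrue-map p f xs)
... | false = countTrue-map p f xs

countTrue-concatMap : {A B : Set} (p : B → Bool) (f : A → List B) (xs : List A) →
  countTrue p (concatMap f xs) ≡ sum (map (countTrue p ∘ f) xs)
countTrue-concatMap p f []       = refl
countTrue-concatMap p f (x ∷ xs) = begin
  countTrue p (f x ++ concatMap f xs)
    ≡⟨ countTrue-++ p (f x) (concatMap f xs) ⟩
  countTrue p (f x) + countTrue p (concatMap f xs)
    ≡⟨ cong (countTrue p (f x) ℕ.+_) (countTrue-concatMap p f xs) ⟩
  countTrue p (f x) + sum (map (countTrue p ∘ f) xs)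
    ∎

-- Paths of s + 1 cells starting in row r and ending in row t.
pathsFrom : (m s : ℕ) → Fin m → ℕ → ℕ
pathsFrom m s r t = countTrue (valid? t) (map (r ∷ᵥ_) (allSeqs m s))

transfer : (m : ℕ) → (Fin m → ℕ) → Fin m → ℕ
transfer m u r = sum (map (λ r′ → if adj? (row r) (row r′) then u r′ else 0) (allFin m))

D-suc : ∀ m s t → D m (suc s) t ≡ sum (map (λ r → pathsFrom m s r t) (allFin m))
D-suc m s t = countTrue-concatMap (valid? t) (λ r → map (r ∷ᵥ_) (allSeqs m s)) (allFin m)

pathsFrom-cons : ∀ m s (r r′ : Fin m) t →
  countTrue (valid? t ∘ (r ∷ᵥ_)) (map (r′ ∷ᵥ_) (allSeqs m s))
    ≡ (if adj? (row r) (row r′) then pathsFrom m s r′ t else 0)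
pathsFrom-cons m s r r′ t = begin
  countTrue (valid? t ∘ (r ∷ᵥ_)) (map (r′ ∷ᵥ_) L)
    ≡⟨ countTrue-map _ (r′ ∷ᵥ_) L ⟩
  countTrue (λ w → (adj ∧ steps? (r′ ∷ᵥ w)) ∧ lastIs? t (r′ ∷ᵥ w)) L
    ≡⟨ countTrue-cong (λ w → ∧-assoc adj (steps? (r′ ∷ᵥ w)) (lastIs? t (r′ ∷ᵥ w))) L ⟩
  countTrue (λ w → adj ∧ valid? t (r′ ∷ᵥ w)) L
    ≡⟨ countTrue-∧ˡ adj _ L ⟩
  (if adj then countTrue (valid? t ∘ (r′ ∷ᵥ_)) L else 0)
    ≡⟨ cong (λ n → if adj then n else 0) (sym (countTrue-map (valid? t) (r′ ∷ᵥ_) L)) ⟩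
  (if adj then pathsFrom m s r′ t else 0)
    ∎
  where
  L = allSeqs m s
  adj = adj? (row r) (row r′)

pathsFrom-suc : ∀ m s r t →
  pathsFrom m (suc s) r t ≡ transfer m (λ r′ → pathsFrom m s r′ t) r
pathsFrom-suc m s r t = begin
  countTrue (valid? t) (map (r ∷ᵥ_) (concatMap (λ r′ → map (r′ ∷ᵥ_) L) (allFin m)))
    ≡⟨ countTrue-map (valid? t) (r ∷ᵥ_) (concatMap (λ r′ → map (r′ ∷ᵥ_) L) (allFin m)) ⟩
  countTrue (valid? t ∘ (r ∷ᵥ_)) (concatMap (λ r′ → map (r′ ∷ᵥ_) L) (allFin m))
    ≡⟨ countTrue-concatMap _ (λ r′ → map (r′ ∷ᵥ_) L) (allFin m) ⟩
  sum (map (λ r′ → countTrue (valid? t ∘ (r ∷ᵥ_)) (map (r′ ∷ᵥ_) L)) (allFin m))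
    ≡⟨ cong sum (map-cong (λ r′ → pathsFrom-cons m s r r′ t) (allFin m)) ⟩
  transfer m (λ r′ → pathsFrom m s r′ t) r
    ∎
  where
  L = allSeqs m s

data ℕ⁴ : Set where
  ⟨_,_,_,_⟩ : ℕ → ℕ → ℕ → ℕ → ℕ⁴

cong₄ : ∀ {a b c d a′ b′ c′ d′} →
  a ≡ a′ → b ≡ b′ → c ≡ c′ → d ≡ d′ → ⟨ a , b , c , d ⟩ ≡ ⟨ a′ , b′ , c′ , d′ ⟩
cong₄ refl refl refl refl = refl

tabulate₄ : (Fin 4 → ℕ) → ℕ⁴
tabulate₄ u = ⟨ u zero , u (suc zero) , u (suc (suc zero)) , u (suc (suc (suc zero))) ⟩
  where open Data.Fin using (zero; suc)

tabulate₄-cong : {u v : Fin 4 → ℕ} → (∀ r → u r ≡ v r) → tabulate₄ u ≡ tabulate₄ v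
tabulate₄-cong u≗v = cong₄ (u≗v _) (u≗v _) (u≗v _) (u≗v _)

𝟙 : ℕ⁴
𝟙 = ⟨ 1 , 1 , 1 , 1 ⟩

adjacency : ℕ⁴ → ℕ⁴
adjacency ⟨ a , b , c , d ⟩ = ⟨ a + b , a + (b + c) , b + (c + d) , c + d ⟩

_·_ : ℕ⁴ → ℕ⁴ → ℕ
⟨ a , b , c , d ⟩ · ⟨ e , f , g , h ⟩ = a * e + (b * f + (c * g + d * h))

adjacency-self-adjoint : ∀ u w → u · adjacency w ≡ adjacency u · w
adjacency-self-adjoint ⟨ a , b , c , d ⟩ ⟨ e , f , g , h ⟩ = identity a b c d e f g h
  where
  identity : ∀ a b c d e f g h →
    a * (e + f) + (b * (e + (f + g)) + (c * (f + (g + h)) + d * (g + h)))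
      ≡ (a + b) * e + ((a + (b + c)) * f + ((b + (c + d)) * g + (c + d) * h))
  identity = solve-∀

transfer₄ : ∀ u → tabulate₄ (transfer 4 u) ≡ adjacency (tabulate₄ u)
transfer₄ u = cong₄ (cong (u₀ ℕ.+_) (+-identityʳ u₁))
                    (cong (λ n → u₀ + (u₁ + n)) (+-identityʳ u₂))
                    (cong (λ n → u₁ + (u₂ + n)) (+-identityʳ u₃))
                    (cong (u₂ ℕ.+_) (+-identityʳ u₃))
  where
  open Data.Fin using (zero; suc)
  u₀ = u zero
  u₁ = u (suc zero)
  u₂ = u (suc (suc zero))
  u₃ = u (suc (suc (suc zero)))

iterate : {A : Set} → (A → A) → ℕ → A → A
iterate f zero    x = x
iterate f (suc n) x = f (iterate f n x)

iterate-comm : {A : Set} (f : A → A) (n : ℕ) (x : A) → iterate f n (f x) ≡ f (iterate f n x)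
iterate-comm f zero    x = refl
iterate-comm f (suc n) x = cong f (iterate-comm f n x)

iterate-self-adjoint : {A B : Set} (_∙_ : A → A → B) (f : A → A) →
  (∀ u w → u ∙ f w ≡ f u ∙ w) → ∀ n u w → u ∙ iterate f n w ≡ iterate f n u ∙ w
iterate-self-adjoint _∙_ f adj zero    u w = refl
iterate-self-adjoint _∙_ f adj (suc n) u w = begin
  u ∙ f (iterate f n w)        ≡⟨ adj u (iterate f n w) ⟩
  f u ∙ iterate f n w          ≡⟨ iterate-self-adjoint _∙_ f adj n (f u) w ⟩
  iterate f n (f u) ∙ w        ≡⟨ cong (_∙ w) (iterate-comm f n u) ⟩
  f (iterate f n u) ∙ w        ∎

pathVector : ℕ → ℕ → ℕ⁴
pathVector s t = tabulate₄ (λ r → pathsFrom 4 s r t)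

pathVector-iterate : ∀ s t → pathVector s t ≡ iterate adjacency s (pathVector 0 t)
pathVector-iterate zero    t = refl
pathVector-iterate (suc s) t = begin
  pathVector (suc s) t
    ≡⟨ tabulate₄-cong (λ r → pathsFrom-suc 4 s r t) ⟩
  tabulate₄ (transfer 4 (λ r → pathsFrom 4 s r t))
    ≡⟨ transfer₄ (λ r → pathsFrom 4 s r t) ⟩
  adjacency (pathVector s t)
    ≡⟨ cong adjacency (pathVector-iterate s t) ⟩
  iterate adjacency (suc s) (pathVector 0 t)
    ∎

D₄-suc : ∀ s t → D 4 (suc s) t ≡ 𝟙 · pathVector s t
D₄-suc s t = trans (D-suc 4 s t)
  (sum≡𝟙· (p zero) (p (suc zero)) (p (suc (suc zero))) (p (suc (suc (suc zero)))))
  where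
  open Data.Fin using (zero; suc)
  p : Fin 4 → ℕ
  p r = pathsFrom 4 s r t
  sum≡𝟙· : ∀ a b c d → a + (b + (c + (d + 0))) ≡ 1 * a + (1 * b + (1 * c + 1 * d))
  sum≡𝟙· = solve-∀

fibVector : ℕ → ℕ⁴
fibVector n = ⟨ F (1 + n) , F (2 + n) , F (2 + n) , F (1 + n) ⟩

adjacency-fibVector : ∀ n → adjacency (fibVector n) ≡ fibVector (2 + n)
adjacency-fibVector n = cong₄ (+-comm x y) (inner x y) (inner′ x y) refl
  where
  x = F (1 + n)
  y = F (2 + n)
  inner : ∀ x y → x + (y + y) ≡ (y + x) + y
  inner = solve-∀
  inner′ : ∀ x y → y + (y + x) ≡ (y + x) + y
  inner′ = solve-∀

iterate-adjacency-𝟙 : ∀ s → iterate adjacency s 𝟙 ≡ fibVector (2 * s)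
iterate-adjacency-𝟙 zero    = refl
iterate-adjacency-𝟙 (suc s) = begin
  adjacency (iterate adjacency s 𝟙) ≡⟨ cong adjacency (iterate-adjacency-𝟙 s) ⟩
  adjacency (fibVector (2 * s))     ≡⟨ adjacency-fibVector (2 * s) ⟩
  fibVector (2 + 2 * s)             ≡⟨ cong fibVector (sym (*-suc 2 s)) ⟩
  fibVector (2 * suc s)             ∎

D₄-suc-fib : ∀ s t → D 4 (suc s) t ≡ fibVector (2 * s) · pathVector 0 t
D₄-suc-fib s t = begin
  D 4 (suc s) t                                  ≡⟨ D₄-suc s t ⟩
  𝟙 · pathVector s t                             ≡⟨ cong (𝟙 ·_) (pathVector-iterate s t) ⟩
  𝟙 · iterate adjacency s (pathVector 0 t)
    ≡⟨ iterate-self-adjoint _·_ adjacency adjacency-self-adjoint s 𝟙 (pathVector 0 t) ⟩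
  iterate adjacency s 𝟙 · pathVector 0 t         ≡⟨ cong (_· pathVector 0 t) (iterate-adjacency-𝟙 s) ⟩
  fibVector (2 * s) · pathVector 0 t             ∎

D₄-row₁ : ∀ s → D 4 (suc s) 1 ≡ F (1 + 2 * s)
D₄-row₁ s = trans (D₄-suc-fib s 1) (first (F (1 + 2 * s)) (F (2 + 2 * s)))
  where
  first : ∀ x y → x * 1 + (y * 0 + (y * 0 + x * 0)) ≡ x
  first = solve-∀

D₄-row₂ : ∀ s → D 4 (suc s) 2 ≡ F (2 + 2 * s)
D₄-row₂ s = trans (D₄-suc-fib s 2) (second (F (1 + 2 * s)) (F (2 + 2 * s)))
  where
  second : ∀ x y → x * 0 + (y * 1 + (y * 0 + x * 0)) ≡ y
  second = solve-∀

-- d'Ocagne's identity F(n+1)F(n+k+3) − F(n+2)F(n+k+2) = (−1)ⁿ F(k+1), with the sign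
-- cases kept apart so that no subtraction occurs.

FibCross⁺ FibCross⁻ : ℕ → ℕ → ℕ → Set
FibCross⁺ n k c = F (1 + n) * F (3 + n + k) ≡ F (2 + n) * F (2 + n + k) + c
FibCross⁻ n k c = F (1 + n) * F (3 + n + k) + c ≡ F (2 + n) * F (2 + n + k)

fibCross⁺⇒fibCross⁻ : ∀ n k c → FibCross⁺ n k c → FibCross⁻ (suc n) k c
fibCross⁺⇒fibCross⁻ n k c = shift (F (1 + n)) (F (2 + n)) (F (2 + n + k)) (F (3 + n + k))
  where
  shift : ∀ x y p q → x * q ≡ y * p + c → y * (q + p) + c ≡ (y + x) * q
  shift x y p q xq≡yp+c = begin
    y * (q + p) + c     ≡⟨ expand y q p c ⟩
    y * q + (y * p + c) ≡⟨ cong (y * q ℕ.+_) (sym xq≡yp+c) ⟩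
    y * q + x * q       ≡⟨ factor y q x ⟩
    (y + x) * q         ∎
    where
    expand : ∀ y q p c → y * (q + p) + c ≡ y * q + (y * p + c)
    expand = solve-∀
    factor : ∀ y q x → y * q + x * q ≡ (y + x) * q
    factor = solve-∀

fibCross⁻⇒fibCross⁺ : ∀ n k c → FibCross⁻ n k c → FibCross⁺ (suc n) k c
fibCross⁻⇒fibCross⁺ n k c = shift (F (1 + n)) (F (2 + n)) (F (2 + n + k)) (F (3 + n + k))
  where
  shift : ∀ x y p q → x * q + c ≡ y * p → y * (q + p) ≡ (y + x) * q + c
  shift x y p q xq+c≡yp = begin
    y * (q + p)         ≡⟨ expand y q p ⟩
    y * q + y * p       ≡⟨ cong (y * q ℕ.+_) (sym xq+c≡yp) ⟩
    y * q + (x * q + c) ≡⟨ factor y q x c ⟩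
    (y + x) * q + c     ∎
    where
    expand : ∀ y q p → y * (q + p) ≡ y * q + y * p
    expand = solve-∀
    factor : ∀ y q x c → y * q + (x * q + c) ≡ (y + x) * q + c
    factor = solve-∀

fibCross-even : ∀ a k → FibCross⁺ (2 * a) k (F (1 + k))
fibCross-even zero    k = base (F (2 + k)) (F (1 + k))
  where
  base : ∀ p q → 1 * (p + q) ≡ 1 * p + q
  base = solve-∀
fibCross-even (suc a) k =
  subst (λ n → FibCross⁺ n k (F (1 + k))) (sym (*-suc 2 a))
    (fibCross⁻⇒fibCross⁺ (1 + 2 * a) k _ (fibCross⁺⇒fibCross⁻ (2 * a) k _ (fibCross-even a k)))

+[m+n]-+m≡+n : ∀ m n → + (m + n) - + m ≡ + n
+[m+n]-+m≡+n m n = begin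
  + (m + n) - + m   ≡⟨ [+m]-[+n]≡m⊖n (m + n) m ⟩
  (m + n) ⊖ m       ≡⟨ ⊖-≥ (m≤m+n m n) ⟩
  + (m + n ∸ m)     ≡⟨ cong +_ (m+n∸m≡n m n) ⟩
  + n               ∎

fib-determinant : ∀ a b →
  + (F (1 + 2 * a) * F (2 + 2 * (a + suc b))) - + (F (2 + 2 * a) * F (1 + 2 * (a + suc b)))
    ≡ + F (2 + 2 * b)
fib-determinant a b = begin
  + (x * F (2 + 2 * (a + suc b))) - + (y * F (1 + 2 * (a + suc b)))
    ≡⟨ cong₂ (λ i j → + (x * F i) - + (y * F j)) (outer a b) (inner a b) ⟨
  + (x * F (3 + 2 * a + k)) - + (y * F (2 + 2 * a + k))
    ≡⟨ cong (λ n → + n - + (y * F (2 + 2 * a + k))) (fibCross-even a k) ⟩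
  + (y * F (2 + 2 * a + k) + F (1 + k)) - + (y * F (2 + 2 * a + k))
    ≡⟨ +[m+n]-+m≡+n (y * F (2 + 2 * a + k)) (F (1 + k)) ⟩
  + F (2 + 2 * b)
    ∎
  where
  x = F (1 + 2 * a)
  y = F (2 + 2 * a)
  k = 1 + 2 * b
  outer : ∀ a b → 3 + 2 * a + (1 + 2 * b) ≡ 2 + 2 * (a + suc b)
  outer = solve-∀
  inner : ∀ a b → 2 + 2 * a + (1 + 2 * b) ≡ 1 + 2 * (a + suc b)
  inner = solve-∀

proposition4p3 : ((s : ℕ) → s ≥ 1 → (D 4 s 1 ≡ F (2 * s ∸ 1)) × (D 4 s 2 ≡ F (2 * s)))
    × ((s t : ℕ) → s ≥ 1 → t ≥ 1 →
    (+ (D 4 s 1 * D 4 (s + t) 2)) - (+ (D 4 s 2 * D 4 (s + t) 1)) ≡ + (D 4 t 2))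
proposition4p3 = rows , determinant
  where
  rows : (s : ℕ) → s ≥ 1 → (D 4 s 1 ≡ F (2 * s ∸ 1)) × (D 4 s 2 ≡ F (2 * s))
  rows (suc a) _ = trans (D₄-row₁ a) (cong F (sym (+-suc a (a + 0))))
                 , trans (D₄-row₂ a) (cong F (sym (*-suc 2 a)))
  determinant : (s t : ℕ) → s ≥ 1 → t ≥ 1 →
    (+ (D 4 s 1 * D 4 (s + t) 2)) - (+ (D 4 s 2 * D 4 (s + t) 1)) ≡ + (D 4 t 2)
  determinant (suc a) (suc b) _ _
    rewrite D₄-row₁ a | D₄-row₂ a | D₄-row₁ (a + suc b) | D₄-row₂ (a + suc b) | D₄-row₂ b
    = fib-determinant a b
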